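{- Let $G$ be a graph with $v$ components. Then for any $v'\leq \frac{v}{2}$ there exists a set $W\subseteq V(G)$ which is isolated in $G$ and satisfies $v'\leq |W|\leq \max\{2v',\frac{2|G|}{v}\}$.
   Context: A set $W\subseteq V(G)$ is isolated in $G$ if there is no edge of $G$ between $W$ and $V(G)\setminus W$. $|G|$ denotes the number of vertices of $G$. -}

module Defs where

open import Data.Nat using (ℕ; _≤_; _*_; _⊔_)
open import Data.Fin using (Fin)
open import Data.Fin.Subset using (Subset; _∈_; _∉_; ∣_∣)
open import Data.Product using (_×_; Σ; ∃)
open import Function.Definitions using (Surjective)
open import Relation.Nullary using (¬_)
open import Relation.Binary.PropositionalEquality using (_≡_)
open import Relation.Binary.Construct.Closure.ReflexiveTransitive using (Star)

-- A finite simple graph on the vertex set Fin n (so |G| = n).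
record Graph (n : ℕ) : Set₁ where
  field
    Adj   : Fin n → Fin n → Set
    sym   : ∀ {x y} → Adj x y → Adj y x
    irrefl : ∀ {x} → ¬ Adj x x

open Graph public

Connected : ∀ {n} → Graph n → Fin n → Fin n → Set
Connected G = Star (Adj G)

-- G has exactly v components: there is a labelling of the vertices by
-- Fin v hitting every label, where two vertices get the same label
-- iff they are connected.
HasComponents : ∀ {n} → Graph n → ℕ → Set
HasComponents {n} G v =
  Σ (Fin n → Fin v) λ c →
    Surjective _≡_ _≡_ c ×
    (∀ x y → (c x ≡ c y → Connected G x y) × (Connected G x y → c x ≡ c y))

Isolated : ∀ {n} → Graph n → Subset n → Set
Isolated G W = ∀ x y → x ∈ W → y ∉ W → ¬ Adj G x y

-- Label the components 1, …, v and let aᵢ ≥ 1 be the size of component i; a union of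
-- components is isolated and its size is the sum of the aᵢ it contains.  If the components
-- with aᵢ ≤ v' have total size at least v', add them one by one: the first partial sum
-- reaching v' is at most v' + v'.  Otherwise fewer than v' components are small, so more
-- than half of the v components are large (aᵢ > v'), and the smallest large one has size
-- at most |G| divided by their number, hence at most 2|G|/v.
module Submission where

open import Defs hiding (sym)
open import Data.Nat using (ℕ; zero; suc; _+_; _*_; _≤_; _<_; z≤n; _≤?_)
open import Data.Nat.Properties hiding (_≟_)
open import Algebra.Properties.CommutativeSemigroup +-commutativeSemigroup using (interchange)
open import Data.Fin using (Fin; zero; suc; _≟_)
open import Data.Fin.Subset
  using (Subset; Side; inside; outside; _∈_; ⊥; ⊤; ⁅_⁆; ∁; ∣_∣; Nonempty)
open import Data.Fin.Subset.Properties
  using (_∈?_; nonempty?; Empty-unique; ∣⊥∣≡0; ∣p∣≤n; ∣∁p∣≡n∸∣p∣; x∈⁅y⁆⇒x≡y; ∣⁅x⁆∣≡1;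
         p⊆q⇒∣p∣≤∣q∣; x∈∁p⇒x∉p)
open import Data.Vec.Base using ([]; _∷_; tabulate; here; there)
open import Data.Vec.Properties using (lookup∘tabulate; []=⇒lookup; lookup⇒[]=)
open import Data.Product using (Σ; ∃; _×_; _,_; proj₁; proj₂)
open import Data.Sum using (_⊎_; inj₁; inj₂; map₂)
open import Function using (_∘_)
open import Function.Definitions using (Surjective)
open import Level using (Level)
open import Relation.Nullary using (yes; no; does; contradiction)
open import Relation.Nullary.Decidable using (dec-true)
open import Relation.Unary using (Pred; Decidable)
open import Relation.Binary.PropositionalEquality
open import Relation.Binary.Construct.Closure.ReflexiveTransitive using (ε; _◅_)

private
  variable
    ℓ : Level
    n v : ℕ

𝟙 : Side → ℕ
𝟙 inside  = 1
𝟙 outside = 0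

∣s∷p∣≡𝟙s+∣p∣ : ∀ s (p : Subset n) → ∣ s ∷ p ∣ ≡ 𝟙 s + ∣ p ∣
∣s∷p∣≡𝟙s+∣p∣ inside  p = refl
∣s∷p∣≡𝟙s+∣p∣ outside p = refl

x∈p⇒0<∣p∣ : ∀ {x} {p : Subset n} → x ∈ p → 0 < ∣ p ∣
x∈p⇒0<∣p∣ {x = x} {p} x∈p = begin
  1         ≡⟨ sym (∣⁅x⁆∣≡1 x) ⟩
  ∣ ⁅ x ⁆ ∣ ≤⟨ p⊆q⇒∣p∣≤∣q∣ (λ y∈⁅x⁆ → subst (_∈ p) (sym (x∈⁅y⁆⇒x≡y x y∈⁅x⁆)) x∈p) ⟩
  ∣ p ∣     ∎
  where open ≤-Reasoning

0<∣p∣⇒Nonempty : ∀ {n} (p : Subset n) → 0 < ∣ p ∣ → Nonempty p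
0<∣p∣⇒Nonempty {n} p 0<∣p∣ with nonempty? p
... | yes ne  = ne
... | no  ¬ne = contradiction (trans (cong ∣_∣ (Empty-unique ¬ne)) (∣⊥∣≡0 n)) (>⇒≢ 0<∣p∣)

select : {P : Pred (Fin n) ℓ} → Decidable P → Subset n
select P? = tabulate (does ∘ P?)

∈-select⁺ : {P : Pred (Fin n) ℓ} (P? : Decidable P) {x : Fin n} → P x → x ∈ select P?
∈-select⁺ P? {x} px = lookup⇒[]= x _ (trans (lookup∘tabulate (does ∘ P?) x) (dec-true (P? x) px))

∈-select⁻ : {P : Pred (Fin n) ℓ} (P? : Decidable P) {x : Fin n} → x ∈ select P? → P x
∈-select⁻ P? {x} x∈ with P? x | trans (sym (lookup∘tabulate (does ∘ P?) x)) ([]=⇒lookup x∈)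
... | yes px | _ = px
... | no  _  | ()

_⁻¹_ : (Fin n → Fin v) → Subset v → Subset n
c ⁻¹ S = select (λ x → c x ∈? S)

fiber : (Fin n → Fin v) → Fin v → Subset n
fiber c i = select (λ x → c x ≟ i)

fiberSize : (Fin n → Fin v) → Fin v → ℕ
fiberSize c i = ∣ fiber c i ∣

weight : (Fin v → ℕ) → Subset v → ℕ
weight a []            = 0
weight a (inside  ∷ S) = a zero + weight (a ∘ suc) S
weight a (outside ∷ S) = weight (a ∘ suc) S

weight-cong : {a b : Fin v → ℕ} → (∀ i → a i ≡ b i) → ∀ S → weight a S ≡ weight b S
weight-cong a≗b []            = refl
weight-cong a≗b (inside  ∷ S) = cong₂ _+_ (a≗b zero) (weight-cong (a≗b ∘ suc) S)
weight-cong a≗b (outside ∷ S) = weight-cong (a≗b ∘ suc) S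

weight-+ : (a b : Fin v → ℕ) → ∀ S → weight (λ i → a i + b i) S ≡ weight a S + weight b S
weight-+ a b []            = refl
weight-+ a b (inside  ∷ S) = begin
  (a zero + b zero) + weight (λ i → a (suc i) + b (suc i)) S
    ≡⟨ cong ((a zero + b zero) +_) (weight-+ (a ∘ suc) (b ∘ suc) S) ⟩
  (a zero + b zero) + (weight (a ∘ suc) S + weight (b ∘ suc) S)
    ≡⟨ interchange (a zero) (b zero) _ _ ⟩
  (a zero + weight (a ∘ suc) S) + (b zero + weight (b ∘ suc) S) ∎
  where open ≡-Reasoning
weight-+ a b (outside ∷ S) = weight-+ (a ∘ suc) (b ∘ suc) S

weight-0 : (S : Subset v) → weight (λ _ → 0) S ≡ 0
weight-0 []            = refl
weight-0 (inside  ∷ S) = weight-0 S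
weight-0 (outside ∷ S) = weight-0 S

weight-⊥ : (a : Fin v → ℕ) → weight a ⊥ ≡ 0
weight-⊥ {zero}  a = refl
weight-⊥ {suc v} a = weight-⊥ (a ∘ suc)

weight-⁅⁆ : (a : Fin v → ℕ) (i : Fin v) → weight a ⁅ i ⁆ ≡ a i
weight-⁅⁆ a zero    = trans (cong (a zero +_) (weight-⊥ (a ∘ suc))) (+-identityʳ (a zero))
weight-⁅⁆ a (suc i) = weight-⁅⁆ (a ∘ suc) i

weight≤weight⊤ : (a : Fin v → ℕ) (S : Subset v) → weight a S ≤ weight a ⊤
weight≤weight⊤ a []            = z≤n
weight≤weight⊤ a (inside  ∷ S) = +-monoʳ-≤ (a zero) (weight≤weight⊤ (a ∘ suc) S)
weight≤weight⊤ a (outside ∷ S) = ≤-trans (weight≤weight⊤ (a ∘ suc) S) (m≤n+m _ (a zero))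

weight-𝟙≟ : (j : Fin v) (S : Subset v) → weight (λ i → 𝟙 (does (j ≟ i))) S ≡ 𝟙 (does (j ∈? S))
weight-𝟙≟ zero    (inside  ∷ S) = cong suc (weight-0 S)
weight-𝟙≟ zero    (outside ∷ S) = weight-0 S
weight-𝟙≟ (suc j) (inside  ∷ S) = weight-𝟙≟ j S
weight-𝟙≟ (suc j) (outside ∷ S) = weight-𝟙≟ j S

∣c⁻¹S∣≡weight-fiberSize : (c : Fin n → Fin v) (S : Subset v) → ∣ c ⁻¹ S ∣ ≡ weight (fiberSize c) S
∣c⁻¹S∣≡weight-fiberSize {zero}  c S = sym (weight-0 S)
∣c⁻¹S∣≡weight-fiberSize {suc n} c S = begin
  ∣ c ⁻¹ S ∣
    ≡⟨ ∣s∷p∣≡𝟙s+∣p∣ (does (c zero ∈? S)) ((c ∘ suc) ⁻¹ S) ⟩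
  𝟙 (does (c zero ∈? S)) + ∣ (c ∘ suc) ⁻¹ S ∣
    ≡⟨ cong₂ _+_ (sym (weight-𝟙≟ (c zero) S)) (∣c⁻¹S∣≡weight-fiberSize (c ∘ suc) S) ⟩
  weight (λ i → 𝟙 (does (c zero ≟ i))) S + weight (fiberSize (c ∘ suc)) S
    ≡⟨ sym (weight-+ _ _ S) ⟩
  weight (λ i → 𝟙 (does (c zero ≟ i)) + fiberSize (c ∘ suc) i) S
    ≡⟨ weight-cong (λ i → sym (∣s∷p∣≡𝟙s+∣p∣ (does (c zero ≟ i)) (fiber (c ∘ suc) i))) S ⟩
  weight (fiberSize c) S ∎
  where open ≡-Reasoning

∣S∣*m≤weight : (a : Fin v → ℕ) {m : ℕ} (S : Subset v) →
               (∀ {i} → i ∈ S → m ≤ a i) → ∣ S ∣ * m ≤ weight a S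
∣S∣*m≤weight a []            m≤a = z≤n
∣S∣*m≤weight a (inside  ∷ S) m≤a = +-mono-≤ (m≤a here) (∣S∣*m≤weight (a ∘ suc) S (m≤a ∘ there))
∣S∣*m≤weight a (outside ∷ S) m≤a = ∣S∣*m≤weight (a ∘ suc) S (m≤a ∘ there)

∃-argmin : (a : Fin v → ℕ) (S : Subset v) → Nonempty S →
           ∃ λ i → i ∈ S × (∀ {j} → j ∈ S → a i ≤ a j)
∃-argmin a (outside ∷ S) (suc i , there i∈S) with ∃-argmin (a ∘ suc) S (i , i∈S)
... | j , j∈S , min = suc j , there j∈S , λ { (there k∈S) → min k∈S }
∃-argmin a (inside ∷ S) _ with nonempty? S
... | no ¬ne = zero , here , λ { here → ≤-refl ; (there k∈S) → contradiction (_ , k∈S) ¬ne }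
... | yes ne with ∃-argmin (a ∘ suc) S ne
...   | j , j∈S , min with a zero ≤? a (suc j)
...     | yes a₀≤aⱼ = zero , here ,
                      λ { here → ≤-refl ; (there k∈S) → ≤-trans a₀≤aⱼ (min k∈S) }
...     | no  a₀≰aⱼ = suc j , there j∈S ,
                      λ { here → <⇒≤ (≰⇒> a₀≰aⱼ) ; (there k∈S) → min k∈S }

∃-weight-between : (a : Fin v → ℕ) {t : ℕ} (S : Subset v) → (∀ {i} → i ∈ S → a i ≤ t) →
                   t ≤ weight a S → ∃ λ T → t ≤ weight a T × weight a T ≤ 2 * t
∃-weight-between a [] _ t≤0 = [] , t≤0 , z≤n
∃-weight-between a (outside ∷ S) a≤t t≤w with ∃-weight-between (a ∘ suc) S (a≤t ∘ there) t≤w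
... | T , t≤wT , wT≤2t = outside ∷ T , t≤wT , wT≤2t
∃-weight-between a {t} (inside ∷ S) a≤t t≤w with t ≤? weight (a ∘ suc) S
... | yes t≤wS with ∃-weight-between (a ∘ suc) S (a≤t ∘ there) t≤wS
...   | T , t≤wT , wT≤2t = outside ∷ T , t≤wT , wT≤2t
∃-weight-between a {t} (inside ∷ S) a≤t t≤w | no t≰wS = inside ∷ S , t≤w , w≤2t
  where
    w≤2t : a zero + weight (a ∘ suc) S ≤ 2 * t
    w≤2t = begin
      a zero + weight (a ∘ suc) S ≤⟨ +-mono-≤ (a≤t here) (<⇒≤ (≰⇒> t≰wS)) ⟩
      t + t                       ≡⟨ cong (t +_) (sym (+-identityʳ t)) ⟩
      2 * t                       ∎
      where open ≤-Reasoning

light : (Fin v → ℕ) → ℕ → Subset v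
light a t = select (λ i → a i ≤? t)

∃-light-heavy-label : (a : Fin v → ℕ) → (∀ i → 0 < a i) → ∀ t → 2 * t ≤ v →
  weight a (light a t) < t → ∃ λ i → t < a i × a i * v ≤ 2 * weight a ⊤
∃-light-heavy-label {v} a 0<a t 2t≤v w<t = i , t<aᵢ , aᵢ*v≤2w⊤
  where
    L H : Subset v
    L = light a t
    H = ∁ L

    ∣L∣<t : ∣ L ∣ < t
    ∣L∣<t = begin-strict
      ∣ L ∣      ≡⟨ sym (*-identityʳ _) ⟩
      ∣ L ∣ * 1  ≤⟨ ∣S∣*m≤weight a L (λ {i} _ → 0<a i) ⟩
      weight a L <⟨ w<t ⟩
      t          ∎
      where open ≤-Reasoning

    ∣L∣+∣H∣≡v : ∣ L ∣ + ∣ H ∣ ≡ v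
    ∣L∣+∣H∣≡v = trans (cong (∣ L ∣ +_) (∣∁p∣≡n∸∣p∣ L)) (m+[n∸m]≡n (∣p∣≤n L))

    t<∣H∣ : t < ∣ H ∣
    t<∣H∣ = +-cancelˡ-< (∣ L ∣) t (∣ H ∣) (begin-strict
      ∣ L ∣ + t     <⟨ +-monoˡ-< t ∣L∣<t ⟩
      t + t         ≡⟨ cong (t +_) (sym (+-identityʳ t)) ⟩
      2 * t         ≤⟨ 2t≤v ⟩
      v             ≡⟨ sym ∣L∣+∣H∣≡v ⟩
      ∣ L ∣ + ∣ H ∣ ∎)
      where open ≤-Reasoning

    ∣L∣<∣H∣ : ∣ L ∣ < ∣ H ∣
    ∣L∣<∣H∣ = <-trans ∣L∣<t t<∣H∣

    v≤2∣H∣ : v ≤ 2 * ∣ H ∣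
    v≤2∣H∣ = begin
      v             ≡⟨ sym ∣L∣+∣H∣≡v ⟩
      ∣ L ∣ + ∣ H ∣ ≤⟨ +-monoˡ-≤ ∣ H ∣ (<⇒≤ ∣L∣<∣H∣) ⟩
      ∣ H ∣ + ∣ H ∣ ≡⟨ cong (∣ H ∣ +_) (sym (+-identityʳ ∣ H ∣)) ⟩
      2 * ∣ H ∣     ∎
      where open ≤-Reasoning

    argmin : ∃ λ i → i ∈ H × (∀ {j} → j ∈ H → a i ≤ a j)
    argmin = ∃-argmin a H (0<∣p∣⇒Nonempty H (≤-<-trans z≤n ∣L∣<∣H∣))

    i : Fin v
    i = proj₁ argmin

    t<aᵢ : t < a i
    t<aᵢ = ≰⇒> (λ aᵢ≤t → x∈∁p⇒x∉p (proj₁ (proj₂ argmin)) (∈-select⁺ (λ i → a i ≤? t) aᵢ≤t))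

    aᵢ*v≤2w⊤ : a i * v ≤ 2 * weight a ⊤
    aᵢ*v≤2w⊤ = begin
      a i * v           ≤⟨ *-monoʳ-≤ (a i) v≤2∣H∣ ⟩
      a i * (2 * ∣ H ∣)   ≡⟨ *-comm (a i) (2 * ∣ H ∣) ⟩
      2 * ∣ H ∣ * a i     ≡⟨ *-assoc 2 ∣ H ∣ (a i) ⟩
      2 * (∣ H ∣ * a i)   ≤⟨ *-monoʳ-≤ 2 (∣S∣*m≤weight a H (proj₂ (proj₂ argmin))) ⟩
      2 * weight a H      ≤⟨ *-monoʳ-≤ 2 (weight≤weight⊤ a H) ⟩
      2 * weight a ⊤    ∎
      where open ≤-Reasoning

∃-balanced-subset : (a : Fin v → ℕ) → (∀ i → 0 < a i) → ∀ t → 2 * t ≤ v →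
  ∃ λ S → t ≤ weight a S × (weight a S ≤ 2 * t ⊎ weight a S * v ≤ 2 * weight a ⊤)
∃-balanced-subset a 0<a t 2t≤v with t ≤? weight a (light a t)
... | yes t≤w with ∃-weight-between a (light a t) (∈-select⁻ (λ i → a i ≤? t)) t≤w
...   | T , t≤wT , wT≤2t = T , t≤wT , inj₁ wT≤2t
∃-balanced-subset a 0<a t 2t≤v | no t≰w
  with ∃-light-heavy-label a 0<a t 2t≤v (≰⇒> t≰w)
... | i , t<aᵢ , aᵢ*v≤2w⊤ rewrite sym (weight-⁅⁆ a i) = ⁅ i ⁆ , <⇒≤ t<aᵢ , inj₂ aᵢ*v≤2w⊤

preimage-isolated : (G : Graph n) (c : Fin n → Fin v) →
  (∀ {x y} → Adj G x y → c x ≡ c y) → (S : Subset v) → Isolated G (c ⁻¹ S)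
preimage-isolated G c adj⇒≡ S x y x∈ y∉ xy =
  y∉ (∈-select⁺ (λ z → c z ∈? S) (subst (_∈ S) (adj⇒≡ xy) (∈-select⁻ (λ z → c z ∈? S) x∈)))

0<fiberSize : (c : Fin n → Fin v) → Surjective _≡_ _≡_ c → ∀ i → 0 < fiberSize c i
0<fiberSize c surj i with surj i
... | x , cx≡i = x∈p⇒0<∣p∣ (∈-select⁺ (λ z → c z ≟ i) (cx≡i refl))

lemma4p2 : (n : ℕ) (G : Graph n) (v : ℕ) → HasComponents G v →
    (v' : ℕ) → 2 * v' ≤ v →
    Σ (Subset n) λ W → Isolated G W × v' ≤ ∣ W ∣ ×
      ((∣ W ∣ ≤ 2 * v') ⊎ (∣ W ∣ * v ≤ 2 * n))
lemma4p2 n G v (c , surj , conn) v' 2v'≤v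
  with ∃-balanced-subset (fiberSize c) (0<fiberSize c surj) v' 2v'≤v
... | S , v'≤w , bound
  rewrite sym (∣c⁻¹S∣≡weight-fiberSize c S) | sym (∣c⁻¹S∣≡weight-fiberSize c ⊤) =
  c ⁻¹ S , preimage-isolated G c (λ xy → proj₂ (conn _ _) (xy ◅ ε)) S , v'≤w ,
  map₂ (λ w*v≤ → ≤-trans w*v≤ (*-monoʳ-≤ 2 (∣p∣≤n (c ⁻¹ ⊤)))) bound
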